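{- Let $G$ be a graph, $z\in\mathbb{N}$, and $\pi=\pi_z(G)$. For any $u,v\in V(G)$ there is at most one index $i\in[p_M(u),p_R(u)-1]$ with $\pi(i)\in[q_M(v),q_M(v)+\deg^-(v)-1]$. Furthermore, for $u<v$, $\{u,v\}\in E(G)$ if and only if there is exactly one such index.
   Context: For integers $a\le b$, $[a,b]=\{a,a+1,\dots,b\}$ and $[m]=[1,m]$. Encoding $\pi_z(G)$ of a graph $G$ and $z\in\mathbb{N}$: identify $V(G)$ with $[n]$ via a total order in which vertices of the same connected component are consecutive. For $v\in[n]$ let $N^+(v)=\{u>v:\{u,v\}\in E(G)\}$, $N^-(v)=\{u<v:\{u,v\}\in E(G)\}$, $\deg^+(v)=|N^+(v)|$, $\deg^-(v)=|N^-(v)|$. Define positions: $p_L(1)=1$, $p_M(1)=z+1$, $p_R(1)=z+1+\deg^+(1)$, and for $v\ge 2$: $p_L(v)=p_R(v-1)+z$, $p_M(v)=p_L(v)+z$, $p_R(v)=p_M(v)+\deg^+(v)$. Define values: $q_L(1)=2z$, $q_M(1)=z+1$, $q_R(1)=z$, and for $v\ge2$: $q_R(v)=q_L(v-1)+z$, $q_M(v)=q_R(v)+1$, $q_L(v)=q_M(v)+z+\deg^-(v)-1$. Then $\pi=\pi_z(G)$ is the permutation on $[2zn+|E(G)|]$ given by: for each $v$ and each $j\in\{0,\dots,z-1\}$, $\pi(p_L(v)+j)=q_L(v)-j$ and $\pi(p_R(v)+j)=q_R(v)-j$; and for each $v$ with $N^+(v)=\{u_1<\dots<u_k\}$ and each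 $i\in[k]$, $\pi(p_M(v)+i-1)=q_M(u_i)+\ell(v,u_i)$, where $\ell(v,u)=|\{w: w<v,\ \{w,u\}\in E(G)\}|$. -}

module Defs where

open import Data.Nat using (ℕ; zero; suc; _+_; _*_; _∸_; _≤_; _<_; _≤ᵇ_; _<ᵇ_)
open import Data.Bool using (Bool; true; false; if_then_else_; _∧_)
open import Data.List using (List; []; _∷_; map; upTo; filterᵇ; length)
open import Data.Product using (_×_)
open import Relation.Binary.PropositionalEquality using (_≡_)

interval : ℕ → ℕ → List ℕ
interval a b = map (a +_) (upTo (suc b ∸ a))

-- A finite simple graph whose vertex set is identified with [n] = {1,…,n}.
record Graph : Set where
  field
    n        : ℕ
    adj      : ℕ → ℕ → Bool
    adj-sym  : ∀ u v → adj u v ≡ adj v u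
    adj-irr  : ∀ v → adj v v ≡ false
    adj-vert : ∀ u v → adj u v ≡ true → (1 ≤ u × u ≤ n)

open Graph public

Edge : Graph → ℕ → ℕ → Set
Edge G u v = adj G u v ≡ true

data Reach (G : Graph) : ℕ → ℕ → Set where
  reach-refl : ∀ v → Reach G v v
  reach-step : ∀ {u w v} → Edge G u w → Reach G w v → Reach G u v

ComponentsConsecutive : Graph → Set
ComponentsConsecutive G =
  ∀ u w v → 1 ≤ u → u ≤ w → w ≤ v → v ≤ n G → Reach G u v → Reach G u w

module Encoding (G : Graph) (z : ℕ) where

  Nplus : ℕ → List ℕ
  Nplus v = filterᵇ (adj G v) (interval (suc v) (n G))

  Nminus : ℕ → List ℕ
  Nminus v = filterᵇ (adj G v) (interval 1 (v ∸ 1))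

  degPlus : ℕ → ℕ
  degPlus v = length (Nplus v)

  degMinus : ℕ → ℕ
  degMinus v = length (Nminus v)

  ell : ℕ → ℕ → ℕ
  ell v u = length (filterᵇ (λ w → adj G w u) (interval 1 (v ∸ 1)))

  -- positions (index 0 is an unused dummy)
  mutual
    pR : ℕ → ℕ
    pR zero = 0
    pR (suc v) = pM (suc v) + degPlus (suc v)

    pM : ℕ → ℕ
    pM zero = 0
    pM (suc zero) = z + 1
    pM (suc (suc v)) = pL (suc (suc v)) + z

    pL : ℕ → ℕ
    pL zero = 0
    pL (suc zero) = 1
    pL (suc (suc v)) = pR (suc v) + z

  -- values (index 0 is an unused dummy)
  mutual
    qL : ℕ → ℕ
    qL zero = 0
    qL (suc zero) = 2 * z
    qL (suc (suc v)) = (qM (suc (suc v)) + z + degMinus (suc (suc v))) ∸ 1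

    qM : ℕ → ℕ
    qM zero = 0
    qM (suc zero) = z + 1
    qM (suc (suc v)) = qR (suc (suc v)) + 1

    qR : ℕ → ℕ
    qR zero = 0
    qR (suc zero) = z
    qR (suc (suc v)) = qL (suc v) + z

  -- k-th element (0-based) of a list, 0 if out of range
  nth : List ℕ → ℕ → ℕ
  nth [] _ = 0
  nth (x ∷ xs) zero = x
  nth (x ∷ xs) (suc k) = nth xs k

  -- the permutation π = π_z(G) on [2zn+|E(G)|] (value 0 outside the domain)
  piAux : List ℕ → ℕ → ℕ
  piAux [] i = 0
  piAux (v ∷ vs) i =
    if (pL v ≤ᵇ i) ∧ (i <ᵇ pL v + z) then qL v ∸ (i ∸ pL v)
    else if (pM v ≤ᵇ i) ∧ (i <ᵇ pR v) then
      (let u = nth (Nplus v) (i ∸ pM v) in qM u + ell v u)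
    else if (pR v ≤ᵇ i) ∧ (i <ᵇ pR v + z) then qR v ∸ (i ∸ pR v)
    else piAux vs i

  pi : ℕ → ℕ
  pi i = piAux (interval 1 (n G)) i

  Hit : ℕ → ℕ → ℕ → Set
  Hit u v i = (pM u ≤ i × i < pR u) × (qM v ≤ pi i × pi i < qM v + degMinus v)

-- The segment of vertex v consists of its L-, M- and R-blocks
-- [pL v, pL v + z), [pM v, pR v), [pR v, pR v + z); within a segment the
-- blocks come in this order, and the segments of 1, 2, …, n follow each other.
-- Hence a position i in the M-block of u is met by no other block, and
-- π(i) = qM(w) + ℓ(u,w) where w is the (i − pM u)-th element of N⁺(u).
--
-- The windows W(v) = [qM v, qM v + deg⁻ v) are increasing in v, hence
-- pairwise disjoint; and for u < w with {u,w} ∈ E the number ℓ(u,w) of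
-- neighbours of w below u is < deg⁻(w), so qM(w) + ℓ(u,w) ∈ W(w).
--
-- Consequently an index i of the M-block of u hits W(v) exactly when the
-- neighbour of u stored at offset i − pM u is v.  As N⁺(u) has no repetitions
-- there is at most one such offset, and there is one iff v ∈ N⁺(u).
module Submission where

open import Defs
open import Data.Nat using (ℕ; zero; suc; _+_; _*_; _∸_; _≤_; _<_; _≤ᵇ_; _<ᵇ_; z≤n; s≤s; s≤s⁻¹)
open import Data.Nat.Properties
open import Data.Bool using (Bool; true; false; _∧_; T; T?)
open import Data.Bool.Properties using (∧-zeroʳ; T-≡)
open import Data.List using (_∷_; _++_; [_]; length; filterᵇ; map; upTo)
open import Data.List.Properties using (length-++; filter-++; filter-≐; map-++; upTo-∷ʳ)
open import Data.List.Membership.Propositional using (_∈_)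
open import Data.List.Membership.Propositional.Properties
  using (∈-map⁺; ∈-map⁻; ∈-upTo⁺; ∈-upTo⁻; ∈-filter⁺; ∈-filter⁻)
open import Data.List.Relation.Unary.Any using (here; there)
import Data.List.Relation.Unary.All as All
open import Data.List.Relation.Unary.AllPairs using (_∷_)
open import Data.List.Relation.Unary.Unique.Propositional using (Unique)
import Data.List.Relation.Unary.Unique.Propositional.Properties as Unique
open import Data.Product using (_×_; Σ; _,_; proj₁; proj₂)
open import Data.Sum using (_⊎_; inj₁; inj₂)
open import Data.Empty using (⊥-elim)
open import Data.Unit using (tt)
open import Function using (_∘_; Equivalence; _⇔_; mk⇔)
open import Relation.Binary using (tri<; tri≈; tri>)
open import Relation.Nullary using (¬_; yes; no)
open import Relation.Binary.PropositionalEquality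
  using (_≡_; _≢_; refl; sym; trans; cong; subst; module ≡-Reasoning)

∈-interval⁻ : ∀ {a b x} → x ∈ interval a b → a ≤ x × x ≤ b
∈-interval⁻ {a} {b} x∈ with ∈-map⁻ (a +_) x∈
... | y , y∈ , refl = m≤m+n a y , s≤s⁻¹ (begin-strict
      a + y              <⟨ +-monoʳ-< a (∈-upTo⁻ y∈) ⟩
      a + (suc b ∸ a)    ≡⟨ m+[n∸m]≡n a≤1+b ⟩
      suc b              ∎)
  where
    open ≤-Reasoning
    -- the range is non-empty since it contains y
    a≤1+b : a ≤ suc b
    a≤1+b = <⇒≤ (m∸n≢0⇒n<m (λ eq → n≮0 (subst (y <_) eq (∈-upTo⁻ y∈))))

∈-interval⁺ : ∀ {a b x} → a ≤ x → x ≤ b → x ∈ interval a b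
∈-interval⁺ {a} {b} {x} a≤x x≤b =
  subst (_∈ interval a b) (m+[n∸m]≡n a≤x) (∈-map⁺ (a +_) (∈-upTo⁺ (∸-monoˡ-< (s≤s x≤b) a≤x)))

interval-unique : ∀ a b → Unique (interval a b)
interval-unique a b = Unique.map⁺ (+-cancelˡ-≡ a _ _) (Unique.upTo⁺ (suc b ∸ a))

interval-snoc : ∀ b → interval 1 (suc b) ≡ interval 1 b ++ [ suc b ]
interval-snoc b = trans (cong (map suc) (sym (upTo-∷ʳ b))) (map-++ suc (upTo b) [ b ])

-- count p b = |{x ∈ [1,b] : p x}|.  Both ℓ(u,w) and deg⁻(w) are prefix
-- counts (of the neighbours of w), which is how they are compared below.
count : (ℕ → Bool) → ℕ → ℕ
count p b = length (filterᵇ p (interval 1 b))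

count-suc : ∀ p b → count p (suc b) ≡ count p b + length (filterᵇ p [ suc b ])
count-suc p b = begin
  length (filterᵇ p (interval 1 (suc b)))                  ≡⟨ cong (length ∘ filterᵇ p) (interval-snoc b) ⟩
  length (filterᵇ p (interval 1 b ++ [ suc b ]))           ≡⟨ cong length (filter-++ (T? ∘ p) (interval 1 b) [ suc b ]) ⟩
  length (filterᵇ p (interval 1 b) ++ filterᵇ p [ suc b ]) ≡⟨ length-++ (filterᵇ p (interval 1 b)) ⟩
  count p b + length (filterᵇ p [ suc b ])                 ∎
  where open ≡-Reasoning

count-mono : ∀ p {b c} → b ≤ c → count p b ≤ count p c
count-mono p {b} {zero} z≤n = ≤-refl
count-mono p {b} {suc c} b≤1+c with m≤n⇒m<n∨m≡n b≤1+c
... | inj₂ refl = ≤-refl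
... | inj₁ b<1+c = ≤-trans (count-mono p (s≤s⁻¹ b<1+c))
                     (≤-trans (m≤m+n (count p c) _) (≤-reflexive (sym (count-suc p c))))

count-hit : ∀ p b → p (suc b) ≡ true → count p b < count p (suc b)
count-hit p b e rewrite count-suc p b | e = m<m+n (count p b) (s≤s z≤n)

count-cong : ∀ {p q} → (∀ x → p x ≡ q x) → ∀ b → count p b ≡ count q b
count-cong {p} {q} p≗q b =
  cong length (filter-≐ (T? ∘ p) (T? ∘ q)
    ((λ {x} → subst T (p≗q x)) , (λ {x} → subst T (sym (p≗q x)))) (interval 1 b))

refute : ∀ {b} → ¬ T b → b ≡ false
refute {false} _ = refl
refute {true} ¬t = ⊥-elim (¬t tt)

inBlock : ℕ → ℕ → ℕ → Bool
inBlock a b i = (a ≤ᵇ i) ∧ (i <ᵇ b)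

inBlock-true : ∀ a b {i} → a ≤ i → i < b → inBlock a b i ≡ true
inBlock-true a b {i} a≤i i<b
  rewrite Equivalence.to T-≡ (≤⇒≤ᵇ a≤i) | Equivalence.to T-≡ (<⇒<ᵇ i<b) = refl

inBlock-false : ∀ a b {i} → i < a ⊎ b ≤ i → inBlock a b i ≡ false
inBlock-false a b {i} (inj₁ i<a) rewrite refute (λ t → <⇒≱ i<a (≤ᵇ⇒≤ a i t)) = refl
inBlock-false a b {i} (inj₂ b≤i) rewrite refute (λ t → <⇒≱ (<ᵇ⇒< i b t) b≤i) = ∧-zeroʳ (a ≤ᵇ i)

module Layout (G : Graph) (z : ℕ) where
  open Encoding G z

  nth-∈ : ∀ xs k → k < length xs → nth xs k ∈ xs
  nth-∈ (x ∷ xs) zero    _          = here refl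
  nth-∈ (x ∷ xs) (suc k) (s≤s k<∣xs∣) = there (nth-∈ xs k k<∣xs∣)

  ∈⇒nth : ∀ {x} xs → x ∈ xs → Σ ℕ λ k → k < length xs × nth xs k ≡ x
  ∈⇒nth (y ∷ xs) (here refl) = 0 , s≤s z≤n , refl
  ∈⇒nth (y ∷ xs) (there x∈) with ∈⇒nth xs x∈
  ... | k , k< , nth≡x = suc k , s≤s k< , nth≡x

  nth-injective : ∀ {xs} k k' → Unique xs → k < length xs → k' < length xs →
    nth xs k ≡ nth xs k' → k ≡ k'
  nth-injective zero zero _ _ _ _ = refl
  nth-injective {x ∷ xs} zero (suc k') (x∉ ∷ _) _ (s≤s k'<) eq =
    ⊥-elim (All.lookup x∉ (nth-∈ xs k' k'<) eq)
  nth-injective {x ∷ xs} (suc k) zero (x∉ ∷ _) (s≤s k<) _ eq =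
    ⊥-elim (All.lookup x∉ (nth-∈ xs k k<) (sym eq))
  nth-injective {x ∷ xs} (suc k) (suc k') (_ ∷ xs-unique) (s≤s k<) (s≤s k'<) eq =
    cong suc (nth-injective k k' xs-unique k< k'< eq)

  Nplus⁻ : ∀ {u w} → w ∈ Nplus u → u < w × Edge G u w
  Nplus⁻ {u} w∈ with ∈-filter⁻ (T? ∘ adj G u) w∈
  ... | w∈range , t = proj₁ (∈-interval⁻ w∈range) , Equivalence.to T-≡ t

  Nplus⁺ : ∀ {u w} → u < w → w ≤ n G → Edge G u w → w ∈ Nplus u
  Nplus⁺ {u} u<w w≤n e = ∈-filter⁺ (T? ∘ adj G u) (∈-interval⁺ u<w w≤n) (Equivalence.from T-≡ e)

  Nplus-unique : ∀ u → Unique (Nplus u)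
  Nplus-unique u = Unique.filter⁺ (T? ∘ adj G u) (interval-unique (suc u) (n G))

  pL+z≤pM : ∀ v → 1 ≤ v → pL v + z ≤ pM v
  pL+z≤pM (suc zero)    _ = ≤-reflexive (+-comm 1 z)
  pL+z≤pM (suc (suc v)) _ = ≤-refl

  pR≡pM+degPlus : ∀ v → 1 ≤ v → pR v ≡ pM v + degPlus v
  pR≡pM+degPlus (suc v) _ = refl

  pM≤pR : ∀ v → 1 ≤ v → pM v ≤ pR v
  pM≤pR v hv = ≤-trans (m≤m+n (pM v) (degPlus v)) (≤-reflexive (sym (pR≡pM+degPlus v hv)))

  pL≤pR : ∀ v → 1 ≤ v → pL v ≤ pR v
  pL≤pR v hv = ≤-trans (m≤m+n (pL v) z) (≤-trans (pL+z≤pM v hv) (pM≤pR v hv))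

  next-segment : ∀ v → 1 ≤ v → pR v + z ≡ pL (suc v)
  next-segment (suc v) _ = refl

  segments-ordered : ∀ v w → 1 ≤ v → v < w → pR v + z ≤ pL w
  segments-ordered v (suc w) hv v<1+w with m<1+n⇒m<n∨m≡n v<1+w
  ... | inj₂ refl = ≤-reflexive (next-segment v hv)
  ... | inj₁ v<w = begin
    pR v + z     ≤⟨ segments-ordered v w hv v<w ⟩
    pL w         ≤⟨ pL≤pR w hw ⟩
    pR w         ≤⟨ m≤m+n (pR w) z ⟩
    pR w + z     ≡⟨ next-segment w hw ⟩
    pL (suc w)   ∎
    where
      open ≤-Reasoning
      hw = ≤-trans hv (<⇒≤ v<w)

  Misses : ℕ → ℕ → Set
  Misses v i = inBlock (pL v) (pL v + z) i ≡ false
             × inBlock (pM v) (pR v) i ≡ false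
             × inBlock (pR v) (pR v + z) i ≡ false

  misses-before : ∀ v i → 1 ≤ v → i < pL v → Misses v i
  misses-before v i hv i<pL =
      inBlock-false (pL v) (pL v + z) (inj₁ i<pL)
    , inBlock-false (pM v) (pR v) (inj₁ (<-≤-trans i<pL (≤-trans (m≤m+n (pL v) z) (pL+z≤pM v hv))))
    , inBlock-false (pR v) (pR v + z) (inj₁ (<-≤-trans i<pL (pL≤pR v hv)))

  misses-after : ∀ v i → 1 ≤ v → pR v + z ≤ i → Misses v i
  misses-after v i hv pR+z≤i =
      inBlock-false (pL v) (pL v + z) (inj₂ (≤-trans (+-monoˡ-≤ z (pL≤pR v hv)) pR+z≤i))
    , inBlock-false (pM v) (pR v) (inj₂ (≤-trans (m≤m+n (pR v) z) pR+z≤i))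
    , inBlock-false (pR v) (pR v + z) (inj₂ pR+z≤i)

  misses-others : ∀ u v i → 1 ≤ u → 1 ≤ v → pM u ≤ i → i < pR u → v ≢ u → Misses v i
  misses-others u v i hu hv pM≤i i<pR v≢u with <-cmp v u
  ... | tri≈ _ v≡u _ = ⊥-elim (v≢u v≡u)
  ... | tri< v<u _ _ = misses-after v i hv (begin
        pR v + z   ≤⟨ segments-ordered v u hv v<u ⟩
        pL u       ≤⟨ m≤m+n (pL u) z ⟩
        pL u + z   ≤⟨ pL+z≤pM u hu ⟩
        pM u       ≤⟨ pM≤i ⟩
        i          ∎)
    where open ≤-Reasoning
  ... | tri> _ _ u<v = misses-before v i hv (begin-strict
        i          <⟨ i<pR ⟩
        pR u       ≤⟨ m≤m+n (pR u) z ⟩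
        pR u + z   ≤⟨ segments-ordered u v hu u<v ⟩
        pL v       ∎)
    where open ≤-Reasoning

  middleValue : ℕ → ℕ → ℕ
  middleValue u i = qM (nth (Nplus u) (i ∸ pM u)) + ell u (nth (Nplus u) (i ∸ pM u))

  piAux-select : ∀ vs i u → u ∈ vs → (∀ v → v ∈ vs → v ≢ u → Misses v i) →
    inBlock (pL u) (pL u + z) i ≡ false → inBlock (pM u) (pR u) i ≡ true →
    piAux vs i ≡ middleValue u i
  piAux-select (v ∷ vs) i u u∈ others-miss notL inM with v ≟ u
  ... | yes refl rewrite notL | inM = refl
  ... | no v≢u with others-miss v (here refl) v≢u | u∈
  ...   | _ | here u≡v = ⊥-elim (v≢u (sym u≡v))
  ...   | notL' , notM' , notR' | there u∈vs rewrite notL' | notM' | notR' =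
          piAux-select vs i u u∈vs (λ w w∈ → others-miss w (there w∈)) notL inM

  -- π on the M-block of u: the only vertex whose block contains i is u.
  pi-middle : ∀ u i → 1 ≤ u → u ≤ n G → pM u ≤ i → i < pR u → pi i ≡ middleValue u i
  pi-middle u i hu u≤n pM≤i i<pR =
    piAux-select (interval 1 (n G)) i u (∈-interval⁺ hu u≤n)
      (λ v v∈ v≢u → misses-others u v i hu (proj₁ (∈-interval⁻ v∈)) pM≤i i<pR v≢u)
      (inBlock-false (pL u) (pL u + z) (inj₂ (≤-trans (pL+z≤pM u hu) pM≤i)))
      (inBlock-true (pM u) (pR u) pM≤i i<pR)

  window-step : ∀ v → 1 ≤ v → qM v + degMinus v ≤ qM (suc v)
  window-step (suc zero) _ = ≤-trans (≤-reflexive (+-identityʳ (z + 1))) (+-monoˡ-≤ 1 (m≤n+m z (2 * z)))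
  window-step v@(suc (suc _)) _ = begin
    qM v + d                     ≤⟨ +-monoˡ-≤ d (m≤m+n (qM v) z) ⟩
    X                            ≤⟨ m≤n+m∸n X 1 ⟩
    1 + (X ∸ 1)                  ≡⟨ +-comm 1 (X ∸ 1) ⟩
    (X ∸ 1) + 1                  ≤⟨ +-monoˡ-≤ 1 (m≤m+n (X ∸ 1) z) ⟩
    qM (suc v)                   ∎
    where
      open ≤-Reasoning
      d = degMinus v
      X = qM v + z + d

  windows-ordered : ∀ v w → 1 ≤ v → v < w → qM v + degMinus v ≤ qM w
  windows-ordered v (suc w) hv v<1+w with m<1+n⇒m<n∨m≡n v<1+w
  ... | inj₂ refl = window-step v hv
  ... | inj₁ v<w = begin
    qM v + degMinus v   ≤⟨ windows-ordered v w hv v<w ⟩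
    qM w                ≤⟨ m≤m+n (qM w) (degMinus w) ⟩
    qM w + degMinus w   ≤⟨ window-step w (≤-trans hv (<⇒≤ v<w)) ⟩
    qM (suc w)          ∎
    where open ≤-Reasoning

  window-owner : ∀ w v e → 1 ≤ w → 1 ≤ v → e < degMinus w →
    qM v ≤ qM w + e → qM w + e < qM v + degMinus v → w ≡ v
  window-owner w v e hw hv e<d v≤ <v with <-cmp w v
  ... | tri≈ _ w≡v _ = w≡v
  ... | tri< w<v _ _ = ⊥-elim (<⇒≱ (<-≤-trans (+-monoʳ-< (qM w) e<d) (windows-ordered w v hw w<v)) v≤)
  ... | tri> _ _ v<w = ⊥-elim (<⇒≱ <v (≤-trans (windows-ordered v w hv v<w) (m≤m+n (qM w) e)))

  -- For an edge {u,w}, u < w, the neighbours of w below u miss u itself,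
  -- so the value qM w + ℓ(u,w) stays inside W(w).
  ell<degMinus : ∀ u w → 1 ≤ u → u < w → Edge G u w → ell u w < degMinus w
  ell<degMinus (suc u) (suc w) _ (s≤s u<w) e = begin-strict
    count adjW u             <⟨ count-hit adjW u e ⟩
    count adjW (suc u)       ≤⟨ count-mono adjW u<w ⟩
    count adjW w             ≡⟨ count-cong (λ x → adj-sym G x (suc w)) w ⟩
    count (adj G (suc w)) w  ∎
    where
      open ≤-Reasoning
      adjW : ℕ → Bool
      adjW x = adj G x (suc w)

  hit-reads : ∀ u v i → 1 ≤ u → u ≤ n G → 1 ≤ v → Hit u v i →
    i ∸ pM u < degPlus u × nth (Nplus u) (i ∸ pM u) ≡ v
  hit-reads u v i hu u≤n hv ((pM≤i , i<pR) , (v≤π , π<v)) = k< , w≡v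
    where
      k = i ∸ pM u
      k< : k < degPlus u
      k< = subst (k <_) (m+n∸m≡n (pM u) (degPlus u))
             (∸-monoˡ-< (subst (i <_) (pR≡pM+degPlus u hu) i<pR) pM≤i)
      w = nth (Nplus u) k
      w-nbr : u < w × Edge G u w
      w-nbr = Nplus⁻ (nth-∈ (Nplus u) k k<)
      π≡ : pi i ≡ qM w + ell u w
      π≡ = pi-middle u i hu u≤n pM≤i i<pR
      w≡v : w ≡ v
      w≡v = window-owner w v (ell u w) (≤-trans hu (<⇒≤ (proj₁ w-nbr))) hv
              (ell<degMinus u w hu (proj₁ w-nbr) (proj₂ w-nbr))
              (subst (qM v ≤_) π≡ v≤π) (subst (_< qM v + degMinus v) π≡ π<v)

  hit-unique : ∀ u v → 1 ≤ u → u ≤ n G → 1 ≤ v → v ≤ n G →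
    ∀ i j → Hit u v i → Hit u v j → i ≡ j
  hit-unique u v hu u≤n hv _ i j hi hj = begin
    i                    ≡⟨ sym (m+[n∸m]≡n (proj₁ (proj₁ hi))) ⟩
    pM u + (i ∸ pM u)    ≡⟨ cong (pM u +_) same-offset ⟩
    pM u + (j ∸ pM u)    ≡⟨ m+[n∸m]≡n (proj₁ (proj₁ hj)) ⟩
    j                    ∎
    where
      open ≡-Reasoning
      reads-i = hit-reads u v i hu u≤n hv hi
      reads-j = hit-reads u v j hu u≤n hv hj
      same-offset : i ∸ pM u ≡ j ∸ pM u
      same-offset = nth-injective _ _ (Nplus-unique u) (proj₁ reads-i) (proj₁ reads-j)
                      (trans (proj₂ reads-i) (sym (proj₂ reads-j)))

  UniqueHit : ℕ → ℕ → Set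
  UniqueHit u v = Σ ℕ λ i → Hit u v i × (∀ j → Hit u v j → j ≡ i)

  edge⇔unique-hit : ∀ u v → 1 ≤ u → u < v → v ≤ n G → (Edge G u v ⇔ UniqueHit u v)
  edge⇔unique-hit u v hu u<v v≤n = mk⇔ edge⇒hit hit⇒edge
    where
      u≤n = ≤-trans (<⇒≤ u<v) v≤n
      hv  = ≤-trans hu (<⇒≤ u<v)

      -- the offset at which v is stored in N⁺(u) is the hit
      edge⇒hit : Edge G u v → UniqueHit u v
      edge⇒hit e with ∈⇒nth (Nplus u) (Nplus⁺ u<v v≤n e)
      ... | k , k< , nth≡v = i , hit , λ j hj → hit-unique u v hu u≤n hv v≤n j i hj hit
        where
          i = pM u + k
          pM≤i = m≤m+n (pM u) k
          i<pR = subst (i <_) (sym (pR≡pM+degPlus u hu)) (+-monoʳ-< (pM u) k<)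
          π≡ : pi i ≡ qM v + ell u v
          π≡ = trans (pi-middle u i hu u≤n pM≤i i<pR)
                 (cong (λ w → qM w + ell u w) (trans (cong (nth (Nplus u)) (m+n∸m≡n (pM u) k)) nth≡v))
          hit : Hit u v i
          hit = (pM≤i , i<pR)
              , subst (qM v ≤_) (sym π≡) (m≤m+n (qM v) (ell u v))
              , subst (_< qM v + degMinus v) (sym π≡) (+-monoʳ-< (qM v) (ell<degMinus u v hu u<v e))

      hit⇒edge : UniqueHit u v → Edge G u v
      hit⇒edge (i , hi , _) with hit-reads u v i hu u≤n hv hi
      ... | k< , nth≡v = subst (Edge G u) nth≡v (proj₂ (Nplus⁻ (nth-∈ (Nplus u) _ k<)))

mainTheorem3 : (G : Graph) → ComponentsConsecutive G → (z : ℕ) →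
    let open Encoding G z in
    (∀ u v → 1 ≤ u → u ≤ n G → 1 ≤ v → v ≤ n G →
      ∀ i j → Hit u v i → Hit u v j → i ≡ j)
    ×
    (∀ u v → 1 ≤ u → u < v → v ≤ n G →
      (Edge G u v ⇔ Σ ℕ (λ i → Hit u v i × (∀ j → Hit u v j → j ≡ i))))
mainTheorem3 G _ z = hit-unique , edge⇔unique-hit
  where open Layout G z
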